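{- Let $\Lambda$ be a non-ordinary acute numerical semigroup with enumeration $\lambda$, conductor $c$, subconductor $c'$ and dominant $d$. Let $m=\min\{\lambda^{ -1}(c+c'-2),\lambda^{ -1}(2d)\}$. Then (1) $\nu_m>\nu_{m+1}$, and (2) $\nu_i\leq\nu_{i+1}$ for all $i>m$.
   Context: A numerical semigroup is a subset $\Lambda\subseteq\mathbb{N}_0$ containing $0$, closed under addition, with finite complement in $\mathbb{N}_0$; the conductor $c$ is the smallest integer with $c+\mathbb{N}_0\subseteq\Lambda$; the enumeration is the increasing bijection $\lambda:\mathbb{N}_0\to\Lambda$. $\nu_i=\#\{j\in\mathbb{N}_0:\lambda_i-\lambda_j\in\Lambda\}$. $\Lambda$ is ordinary if $\Lambda=\{0\}\cup\{i\in\mathbb{N}_0:i\geq c\}$. For $\Lambda\neq\mathbb{N}_0$, the dominant $d$ is the largest element of $\Lambda$ smaller than $c$, and the subconductor $c'$ is the smallest element of $\Lambda$ such that every integer in $[c',d]$ lies in $\Lambda$. For non-ordinary $\Lambda$, the subdominant $d'$ is the largest element of $\Lambda$ smaller than $c'$. $\Lambda$ is acute if it is ordinary or it is non-ordinary with $c-d\leq c'-d'$. (For non-ordinary $\Lambda$, both $c+c'-2$ and $2d$ are elements of $\Lambda$.) -}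

module Defs where

open import Data.Nat using (ℕ; zero; suc; _+_; _*_; _∸_; _≤_; _<_; _≤ᵇ_)
open import Data.Bool using (Bool; true; false; T; _∧_)
open import Data.Product using (Σ; _×_; ∃)
open import Data.Sum using (_⊎_)
open import Relation.Nullary using (¬_)
open import Relation.Binary.PropositionalEquality using (_≡_)

record NumericalSemigroup : Set where
  field
    mem      : ℕ → Bool
    zero∈    : T (mem 0)
    closed   : ∀ a b → T (mem a) → T (mem b) → T (mem (a + b))
    cofinite : ∃ λ N → ∀ n → N ≤ n → T (mem n)

open NumericalSemigroup public

_∈_ : ℕ → NumericalSemigroup → Set
x ∈ Λ = T (mem Λ x)

IsEnumeration : NumericalSemigroup → (ℕ → ℕ) → Set
IsEnumeration Λ lam =
  (∀ i → lam i ∈ Λ) ×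
  (∀ i j → i < j → lam i < lam j) ×
  (∀ x → x ∈ Λ → ∃ λ i → lam i ≡ x)

IsConductor : NumericalSemigroup → ℕ → Set
IsConductor Λ c =
  (∀ n → c ≤ n → n ∈ Λ) ×
  (∀ c₀ → (∀ n → c₀ ≤ n → n ∈ Λ) → c ≤ c₀)

IsOrdinary : NumericalSemigroup → ℕ → Set
IsOrdinary Λ c = ∀ i → (i ∈ Λ → i ≡ 0 ⊎ c ≤ i) × (i ≡ 0 ⊎ c ≤ i → i ∈ Λ)

IsDominant : NumericalSemigroup → ℕ → ℕ → Set
IsDominant Λ c d = d ∈ Λ × d < c × (∀ x → x ∈ Λ → x < c → x ≤ d)

IsSubconductor : NumericalSemigroup → ℕ → ℕ → Set
IsSubconductor Λ d c' =
  c' ∈ Λ × (∀ k → c' ≤ k → k ≤ d → k ∈ Λ) ×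
  (∀ y → y ∈ Λ → (∀ k → y ≤ k → k ≤ d → k ∈ Λ) → c' ≤ y)

IsSubdominant : NumericalSemigroup → ℕ → ℕ → Set
IsSubdominant Λ c' d' = d' ∈ Λ × d' < c' × (∀ x → x ∈ Λ → x < c' → x ≤ d')

IsAcute : NumericalSemigroup → (c d c' d' : ℕ) → Set
IsAcute Λ c d c' d' = IsOrdinary Λ c ⊎ ((¬ IsOrdinary Λ c) × c ∸ d ≤ c' ∸ d')

countBelow : (ℕ → Bool) → ℕ → ℕ
countBelow f zero = zero
countBelow f (suc n) with f n
... | true  = suc (countBelow f n)
... | false = countBelow f n

-- ν_i = #{ j : λ_i - λ_j ∈ Λ }.  Since λ is increasing, only j ≤ i can
-- satisfy λ_j ≤ λ_i, so it suffices to count over j < i + 1.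
ν : NumericalSemigroup → (ℕ → ℕ) → ℕ → ℕ
ν Λ lam i = countBelow (λ j → (lam j ≤ᵇ lam i) ∧ mem Λ (lam i ∸ lam j)) (suc i)

module Submission where

-- Write μ for the membership test of Λ, F = c − 1 for the Frobenius number
-- (the largest gap) and F' = c' − 1 (the largest gap below d).
--
-- 1. Since the enumeration skips no element of Λ, ν_i = rep(λ_i), where rep(x)
--    is the number of a ≤ x with a ∈ Λ and x − a ∈ Λ.
-- 2. Inclusion–exclusion over the pairs (a, x − a) shows, for any set
--    containing 0 and x + 1,
--      rep(x+1) + gapPairs(x) = rep(x) + 1 + gapPairs⁺(x),
--    where gapPairs(x) counts the a ≤ x with a and x − a gaps, and gapPairs⁺(x)
--    those with a + 1 and x − a gaps.
-- 3. Above d' the gaps of Λ form the two intervals (d', F'] and (d, F], whose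
--    boundary points are F', d and F.  Hence for x > d' + F
--      rep(x+1) + [x−F' gap] + [x−F gap] = rep(x) + 1 + [x−d gap].
-- 4. Acuteness gives d' + F < 2d, so this formula holds from x₀ = min(F+F', 2d)
--    on.  At x₀ both x₀ − F' and x₀ − F are gaps while x₀ − d ∈ Λ: rep drops
--    by one.  Beyond x₀ either x − F' ∈ Λ or x − d is a gap: rep never drops.
-- 5. Finally x₀ = λ_m because λ is monotone and λ_{k₁} = F + F', λ_{k₂} = 2d.

open import Defs
open import Data.Nat
  using (ℕ; zero; suc; _+_; _*_; _∸_; _≤_; _<_; _>_; _⊓_; z≤n; s≤s; s≤s⁻¹; _≤ᵇ_; _≤′_; ≤′-reflexive; ≤′-step)
open import Data.Nat.Properties
open import Data.Nat.Tactic.RingSolver using (solve-∀)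
open import Algebra.Properties.CommutativeSemigroup +-commutativeSemigroup using (interchange; x∙yz≈y∙xz; x∙yz≈yx∙z)
open import Data.Bool using (Bool; true; false; T; _∧_; not)
open import Data.Bool.Properties using (∧-zeroʳ; ∧-identityʳ)
open import Data.Product using (_×_; _,_; proj₁; proj₂; ∃; uncurry)
open import Data.Sum using (inj₁; inj₂)
open import Relation.Nullary using (¬_; yes; no; contradiction)
open import Relation.Binary.Definitions using (tri<; tri≈; tri>)
open import Relation.Binary.PropositionalEquality

-- χ b ∈ {0, 1} is the indicator of a boolean; membership in Defs is stated
-- with T, while the counting below computes with booleans.
χ : Bool → ℕ
χ true  = 1
χ false = 0

χ≤1 : ∀ b → χ b ≤ 1
χ≤1 true  = ≤-refl
χ≤1 false = z≤n

T⇒true : ∀ {b} → T b → b ≡ true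
T⇒true {true} _ = refl

¬T⇒false : ∀ {b} → ¬ T b → b ≡ false
¬T⇒false {true}  b∉ = contradiction _ b∉
¬T⇒false {false} _  = refl

δ : ℕ → ℕ → ℕ
δ t a with a ≟ t
... | yes _ = 1
... | no  _ = 0

δ-same : ∀ t → δ t t ≡ 1
δ-same t with t ≟ t
... | yes _   = refl
... | no  t≢t = contradiction refl t≢t

δ-other : ∀ {t a} → a ≢ t → δ t a ≡ 0
δ-other {t} {a} a≢t with a ≟ t
... | yes a≡t = contradiction a≡t a≢t
... | no  _   = refl

sum< : ℕ → (ℕ → ℕ) → ℕ
sum< zero    f = 0
sum< (suc n) f = f n + sum< n f

syntax sum< n (λ a → e) = ∑[ a < n ] e

sum-cong : ∀ n {f g : ℕ → ℕ} → (∀ a → a < n → f a ≡ g a) → sum< n f ≡ sum< n g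
sum-cong zero    f≗g = refl
sum-cong (suc n) f≗g = cong₂ _+_ (f≗g n ≤-refl) (sum-cong n (λ a a<n → f≗g a (m<n⇒m<1+n a<n)))

sum-+ : ∀ n (f g : ℕ → ℕ) → ∑[ a < n ] (f a + g a) ≡ sum< n f + sum< n g
sum-+ zero    f g = refl
sum-+ (suc n) f g =
  trans (cong (f n + g n +_) (sum-+ n f g)) (interchange (f n) (g n) (sum< n f) (sum< n g))

sum-ones : ∀ n → (∑[ a < n ] 1) ≡ n
sum-ones zero    = refl
sum-ones (suc n) = cong suc (sum-ones n)

sum-shift : ∀ n (f : ℕ → ℕ) → sum< (suc n) f ≡ f 0 + ∑[ a < n ] f (suc a)
sum-shift zero    f = refl
sum-shift (suc n) f =
  trans (cong (f (suc n) +_) (sum-shift n f)) (x∙yz≈y∙xz (f (suc n)) (f 0) _)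

sum-extend : ∀ {m n} (f : ℕ → ℕ) → m ≤′ n → (∀ a → m ≤ a → a < n → f a ≡ 0) → sum< n f ≡ sum< m f
sum-extend f (≤′-reflexive refl) vanish = refl
sum-extend {m} {suc n} f (≤′-step m≤′n) vanish =
  cong₂ _+_ (vanish n (≤′⇒≤ m≤′n) ≤-refl)
            (sum-extend f m≤′n (λ a m≤a a<n → vanish a m≤a (m<n⇒m<1+n a<n)))

sum-δ-outside : ∀ t n (f : ℕ → ℕ) → n ≤ t → ∑[ a < n ] (δ t a * f a) ≡ 0
sum-δ-outside t zero    f _   = refl
sum-δ-outside t (suc n) f n<t =
  cong₂ _+_ (cong (_* f n) (δ-other (<⇒≢ n<t))) (sum-δ-outside t n f (<⇒≤ n<t))

sum-δ : ∀ t n (f : ℕ → ℕ) → t < n → ∑[ a < n ] (δ t a * f a) ≡ f t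
sum-δ t (suc n) f t<1+n with m≤n⇒m<n∨m≡n (s≤s⁻¹ t<1+n)
... | inj₁ t<n  = cong₂ _+_ (cong (_* f n) (δ-other (>⇒≢ t<n))) (sum-δ t n f t<n)
... | inj₂ refl = begin
  δ t t * f t + ∑[ a < t ] (δ t a * f a)
    ≡⟨ cong₂ _+_ (cong (_* f t) (δ-same t)) (sum-δ-outside t t f ≤-refl) ⟩
  1 * f t + 0
    ≡⟨ trans (+-identityʳ _) (*-identityˡ (f t)) ⟩
  f t ∎
  where open ≡-Reasoning

countBelow-sum : ∀ p n → countBelow p n ≡ ∑[ a < n ] χ (p a)
countBelow-sum p zero = refl
countBelow-sum p (suc n) with p n
... | true  = cong suc (countBelow-sum p n)
... | false = countBelow-sum p n

-- Subtracting two instances r + g + g' = y + 1 + p and r' + g + g' = y + 2 + p'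
-- of inclusion–exclusion that share their gap counts g, g'.
subtract-instances : ∀ r r' g g' y p p' → r + g + g' ≡ suc y + p → r' + g + g' ≡ suc (suc y) + p' → r' + p ≡ suc (r + p')
subtract-instances r r' g g' y p p' e e' = +-cancelʳ-≡ (g + g') _ _ (begin
  r' + p + (g + g')       ≡⟨ move r' p g g' ⟩
  r' + g + g' + p         ≡⟨ cong (_+ p) e' ⟩
  suc (suc y) + p' + p    ≡⟨ move' y p' p ⟩
  suc (suc y + p) + p'    ≡⟨ cong (λ z → suc z + p') (sym e) ⟩
  suc (r + g + g') + p'   ≡⟨ move'' r g g' p' ⟩
  suc (r + p') + (g + g') ∎)
  where
  open ≡-Reasoning
  move : ∀ a b c d → a + b + (c + d) ≡ a + c + d + b
  move = solve-∀
  move' : ∀ a b c → suc (suc a) + b + c ≡ suc (suc a + c) + b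
  move' = solve-∀
  move'' : ∀ a b c d → suc (a + b + c) + d ≡ suc (a + d) + (b + c)
  move'' = solve-∀

∸-between : ∀ {x y lo hi} → lo + y < x → x ≤ y + hi → lo < x ∸ y × x ∸ y ≤ hi
∸-between {x} {y} {lo} lo+y<x x≤y+hi = m+n≤o⇒m≤o∸n (suc lo) lo+y<x , m≤n+o⇒m∸n≤o x y x≤y+hi

-- Combining the step of rep with the boundary identity for gap pairs.
eliminate-gapPairs : ∀ r r' p p' u v w → r' + p ≡ suc (r + p') → p + w ≡ p' + u + v → r' + u + v ≡ suc r + w
eliminate-gapPairs r r' p p' u v w step boundary = +-cancelʳ-≡ p' _ _ (begin
  r' + u + v + p'   ≡⟨ move r' u v p' ⟩
  r' + (p' + u + v) ≡⟨ cong (r' +_) (sym boundary) ⟩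
  r' + (p + w)      ≡⟨ sym (+-assoc r' p w) ⟩
  r' + p + w        ≡⟨ cong (_+ w) step ⟩
  suc (r + p') + w  ≡⟨ move' r p' w ⟩
  suc r + w + p'    ∎)
  where
  open ≡-Reasoning
  move : ∀ a b c d → a + b + c + d ≡ a + (d + b + c)
  move = solve-∀
  move' : ∀ a b c → suc (a + b) + c ≡ suc a + c + b
  move' = solve-∀

drop-by-one : ∀ {r r'} → r' + 1 + 1 ≡ suc r + 0 → r ≡ suc r'
drop-by-one {r} {r'} e = suc-injective (begin
  suc r         ≡⟨ sym (+-identityʳ (suc r)) ⟩
  suc r + 0     ≡⟨ sym e ⟩
  r' + 1 + 1    ≡⟨ +-comm (r' + 1) 1 ⟩
  suc (r' + 1)  ≡⟨ cong suc (+-comm r' 1) ⟩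
  suc (suc r')  ∎)
  where open ≡-Reasoning

no-drop : ∀ {r r' u v w} → r' + u + v ≡ suc r + w → u ≤ w → v ≤ 1 → r ≤ r'
no-drop {r} {r'} {u} {v} {w} e u≤w v≤1 = +-cancelʳ-≤ w r r' (s≤s⁻¹ (begin
  suc (r + w)   ≡⟨ sym e ⟩
  r' + u + v    ≤⟨ +-mono-≤ (+-monoʳ-≤ r' u≤w) v≤1 ⟩
  r' + w + 1    ≡⟨ +-comm (r' + w) 1 ⟩
  suc (r' + w)  ∎))
  where open ≤-Reasoning

module PairCounts (μ : ℕ → Bool) where

  gap : ℕ → Bool
  gap a = not (μ a)

  rep gapCount coGapCount gapPairs gapPairs⁺ : ℕ → ℕ
  rep x        = ∑[ a < suc x ] χ (μ a ∧ μ (x ∸ a))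
  gapCount x   = ∑[ a < suc x ] χ (gap a)
  coGapCount x = ∑[ a < suc x ] χ (gap (x ∸ a))
  gapPairs x   = ∑[ a < suc x ] χ (gap a ∧ gap (x ∸ a))
  gapPairs⁺ x  = ∑[ a < suc x ] χ (gap (suc a) ∧ gap (x ∸ a))

  -- A pair of elements is counted once by rep, a pair with one gap once by a
  -- gap count, a pair of two gaps twice by the gap counts and once by gapPairs.
  pair-inclusion-exclusion : ∀ u v → χ (u ∧ v) + χ (not u) + χ (not v) ≡ 1 + χ (not u ∧ not v)
  pair-inclusion-exclusion true  true  = refl
  pair-inclusion-exclusion true  false = refl
  pair-inclusion-exclusion false true  = refl
  pair-inclusion-exclusion false false = refl

  inclusion-exclusion : ∀ x → rep x + gapCount x + coGapCount x ≡ suc x + gapPairs x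
  inclusion-exclusion x = begin
    rep x + gapCount x + coGapCount x
      ≡⟨ cong (_+ coGapCount x) (sym (sum-+ (suc x) both gap₁)) ⟩
    ∑[ a < suc x ] (both a + gap₁ a) + coGapCount x
      ≡⟨ sym (sum-+ (suc x) (λ a → both a + gap₁ a) gap₂) ⟩
    ∑[ a < suc x ] (both a + gap₁ a + gap₂ a)
      ≡⟨ sum-cong (suc x) (λ a _ → pair-inclusion-exclusion (μ a) (μ (x ∸ a))) ⟩
    ∑[ a < suc x ] (1 + gap₁₂ a)
      ≡⟨ sum-+ (suc x) (λ _ → 1) gap₁₂ ⟩
    (∑[ a < suc x ] 1) + gapPairs x
      ≡⟨ cong (_+ gapPairs x) (sum-ones (suc x)) ⟩
    suc x + gapPairs x ∎
    where
    open ≡-Reasoning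
    both gap₁ gap₂ gap₁₂ : ℕ → ℕ
    both a  = χ (μ a ∧ μ (x ∸ a))
    gap₁ a  = χ (gap a)
    gap₂ a  = χ (gap (x ∸ a))
    gap₁₂ a = χ (gap a ∧ gap (x ∸ a))

  -- Passing from x to x + 1 ∈ μ keeps both gap counts and, as 0 ∈ μ,
  -- turns gapPairs(x+1) into gapPairs⁺(x).
  gapCount-suc : ∀ x → μ (suc x) ≡ true → gapCount (suc x) ≡ gapCount x
  gapCount-suc x x+1∈ = cong (λ b → χ (not b) + gapCount x) x+1∈

  coGapCount-suc : ∀ x → μ (suc x) ≡ true → coGapCount (suc x) ≡ coGapCount x
  coGapCount-suc x x+1∈ =
    trans (sum-shift (suc x) (λ a → χ (gap (suc x ∸ a)))) (cong (λ b → χ (not b) + coGapCount x) x+1∈)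

  gapPairs-suc : μ 0 ≡ true → ∀ x → gapPairs (suc x) ≡ gapPairs⁺ x
  gapPairs-suc 0∈ x =
    trans (sum-shift (suc x) (λ a → χ (gap a ∧ gap (suc x ∸ a))))
          (cong (λ b → χ (not b ∧ gap (suc x)) + gapPairs⁺ x) 0∈)

  -- Inclusion–exclusion at x and at x + 1, subtracted.
  rep-suc : μ 0 ≡ true → ∀ x → μ (suc x) ≡ true → rep (suc x) + gapPairs x ≡ suc (rep x + gapPairs⁺ x)
  rep-suc 0∈ x x+1∈ = subtract-instances (rep x) (rep (suc x)) (gapCount x) (coGapCount x) x (gapPairs x) (gapPairs⁺ x)
                                          (inclusion-exclusion x) (begin
    rep (suc x) + gapCount x + coGapCount x
      ≡⟨ cong₂ (λ g g' → rep (suc x) + g + g') (sym (gapCount-suc x x+1∈)) (sym (coGapCount-suc x x+1∈)) ⟩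
    rep (suc x) + gapCount (suc x) + coGapCount (suc x)
      ≡⟨ inclusion-exclusion (suc x) ⟩
    suc (suc x) + gapPairs (suc x)
      ≡⟨ cong (suc (suc x) +_) (gapPairs-suc 0∈ x) ⟩
    suc (suc x) + gapPairs⁺ x ∎)
    where open ≡-Reasoning

-- Sets whose gaps above d' are the two intervals (d', F'] and (d, F], with
-- everything in (F', d] and above F an element, and satisfying the acuteness
-- inequality d' + F ≤ F' + d (i.e. c − d ≤ c' − d').

module TwoGapIntervals (μ : ℕ → Bool) (d' F' d F : ℕ)
  (d'<F' : d' < F') (F'<d : F' < d) (d<F : d < F)
  (0∈       : μ 0 ≡ true)
  (lowGaps  : ∀ a → d' < a → a ≤ F' → μ a ≡ false)
  (middle   : ∀ a → F' < a → a ≤ d → μ a ≡ true)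
  (highGaps : ∀ a → d < a → a ≤ F → μ a ≡ false)
  (beyond   : ∀ a → F < a → μ a ≡ true)
  (acute    : d' + F ≤ F' + d)
  where

  open PairCounts μ

  χgap-member : ∀ {b} → μ b ≡ true → χ (gap b) ≡ 0
  χgap-member b∈ = cong (λ v → χ (not v)) b∈

  χgap-gap : ∀ {b} → μ b ≡ false → χ (gap b) ≡ 1
  χgap-gap b∉ = cong (λ v → χ (not v)) b∉

  -- Above d' a gap followed by an element occurs exactly at F' and F, and an
  -- element followed by a gap exactly at d.
  boundary : ∀ a → d' < a → χ (gap a) + δ d a ≡ χ (gap (suc a)) + δ F' a + δ F a
  boundary a d'<a with <-cmp a F'
  ... | tri< a<F' _ _
    rewrite lowGaps a d'<a (<⇒≤ a<F') | lowGaps (suc a) (m<n⇒m<1+n d'<a) a<F'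
          | δ-other {d} (<⇒≢ (<-trans a<F' F'<d)) | δ-other {F'} (<⇒≢ a<F')
          | δ-other {F} (<⇒≢ (<-trans a<F' (<-trans F'<d d<F))) = refl
  ... | tri≈ _ refl _
    rewrite lowGaps a d'<a ≤-refl | middle (suc a) ≤-refl F'<d
          | δ-other {d} (<⇒≢ F'<d) | δ-same a | δ-other {F} (<⇒≢ (<-trans F'<d d<F)) = refl
  ... | tri> _ _ F'<a with <-cmp a d
  ...   | tri< a<d _ _
    rewrite middle a F'<a (<⇒≤ a<d) | middle (suc a) (m<n⇒m<1+n F'<a) a<d
          | δ-other {d} (<⇒≢ a<d) | δ-other {F'} (>⇒≢ F'<a)
          | δ-other {F} (<⇒≢ (<-trans a<d d<F)) = refl
  ...   | tri≈ _ refl _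
    rewrite middle a F'<a ≤-refl | highGaps (suc a) ≤-refl d<F
          | δ-same a | δ-other {F'} (>⇒≢ F'<a) | δ-other {F} (<⇒≢ d<F) = refl
  ...   | tri> _ _ d<a with <-cmp a F
  ...     | tri< a<F _ _
    rewrite highGaps a d<a (<⇒≤ a<F) | highGaps (suc a) (m<n⇒m<1+n d<a) a<F
          | δ-other {d} (>⇒≢ d<a) | δ-other {F'} (>⇒≢ F'<a) | δ-other {F} (<⇒≢ a<F) = refl
  ...     | tri≈ _ refl _
    rewrite highGaps a d<a ≤-refl | beyond (suc a) ≤-refl
          | δ-other {d} (>⇒≢ d<a) | δ-other {F'} (>⇒≢ F'<a) | δ-same a = refl
  ...     | tri> _ _ F<a
    rewrite beyond a F<a | beyond (suc a) (m<n⇒m<1+n F<a)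
          | δ-other {d} (>⇒≢ d<a) | δ-other {F'} (>⇒≢ F'<a) | δ-other {F} (>⇒≢ F<a) = refl

  boundary-weighted : ∀ a g → (g ≡ true → d' < a) →
    χ (gap a ∧ g) + δ d a * χ g ≡ χ (gap (suc a) ∧ g) + δ F' a * χ g + δ F a * χ g
  boundary-weighted a false _
    rewrite ∧-zeroʳ (gap a) | ∧-zeroʳ (gap (suc a))
          | *-zeroʳ (δ d a) | *-zeroʳ (δ F' a) | *-zeroʳ (δ F a) = refl
  boundary-weighted a true above
    rewrite ∧-identityʳ (gap a) | ∧-identityʳ (gap (suc a))
          | *-identityʳ (δ d a) | *-identityʳ (δ F' a) | *-identityʳ (δ F a) = boundary a (above refl)

  gap-below-F : ∀ {b} → gap b ≡ true → b ≤ F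
  gap-below-F {b} b-gap with b ≤? F
  ... | yes b≤F = b≤F
  ... | no  b≰F = contradiction (trans (cong not (sym (beyond b (≰⇒> b≰F)))) b-gap) λ ()

  complement-above-d' : ∀ {x a} → suc d' + F ≤ x → a ≤ x → gap (x ∸ a) ≡ true → d' < a
  complement-above-d' {x} {a} d'+F<x a≤x x∸a-gap = +-cancelʳ-≤ F (suc d') a (begin
    suc d' + F   ≤⟨ d'+F<x ⟩
    x            ≡⟨ sym (m+[n∸m]≡n a≤x) ⟩
    a + (x ∸ a)  ≤⟨ +-monoʳ-≤ a (gap-below-F x∸a-gap) ⟩
    a + F        ∎)
    where open ≤-Reasoning

  -- Summing the weighted boundary identity over a ≤ x.
  gapPairs-boundary : ∀ x → suc d' + F ≤ x →
    gapPairs x + χ (gap (x ∸ d)) ≡ gapPairs⁺ x + χ (gap (x ∸ F')) + χ (gap (x ∸ F))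
  gapPairs-boundary x d'+F<x = begin
    gapPairs x + w d
      ≡⟨ cong (gapPairs x +_) (sym (sum-δ d (suc x) w (s≤s d≤x))) ⟩
    gapPairs x + ∑[ a < suc x ] (δ d a * w a)
      ≡⟨ sym (sum-+ (suc x) gap₁₂ (λ a → δ d a * w a)) ⟩
    ∑[ a < suc x ] (gap₁₂ a + δ d a * w a)
      ≡⟨ sum-cong (suc x) (λ a a≤x → boundary-weighted a (gap (x ∸ a))
                                        (complement-above-d' d'+F<x (s≤s⁻¹ a≤x))) ⟩
    ∑[ a < suc x ] (gap⁺₁₂ a + δ F' a * w a + δ F a * w a)
      ≡⟨ sum-+ (suc x) (λ a → gap⁺₁₂ a + δ F' a * w a) (λ a → δ F a * w a) ⟩
    ∑[ a < suc x ] (gap⁺₁₂ a + δ F' a * w a) + ∑[ a < suc x ] (δ F a * w a)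
      ≡⟨ cong (_+ ∑[ a < suc x ] (δ F a * w a)) (sum-+ (suc x) gap⁺₁₂ (λ a → δ F' a * w a)) ⟩
    gapPairs⁺ x + ∑[ a < suc x ] (δ F' a * w a) + ∑[ a < suc x ] (δ F a * w a)
      ≡⟨ cong₂ (λ u v → gapPairs⁺ x + u + v) (sum-δ F' (suc x) w (s≤s F'≤x)) (sum-δ F (suc x) w (s≤s F≤x)) ⟩
    gapPairs⁺ x + w F' + w F ∎
    where
    open ≡-Reasoning
    w gap₁₂ gap⁺₁₂ : ℕ → ℕ
    w a      = χ (gap (x ∸ a))
    gap₁₂ a  = χ (gap a ∧ gap (x ∸ a))
    gap⁺₁₂ a = χ (gap (suc a) ∧ gap (x ∸ a))
    F≤x : F ≤ x
    F≤x = m+n≤o⇒n≤o (suc d') d'+F<x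
    d≤x : d ≤ x
    d≤x = ≤-trans (<⇒≤ d<F) F≤x
    F'≤x : F' ≤ x
    F'≤x = ≤-trans (<⇒≤ F'<d) d≤x

  rep-step : ∀ x → suc d' + F ≤ x →
    rep (suc x) + χ (gap (x ∸ F')) + χ (gap (x ∸ F)) ≡ suc (rep x) + χ (gap (x ∸ d))
  rep-step x d'+F<x =
    eliminate-gapPairs (rep x) (rep (suc x)) (gapPairs x) (gapPairs⁺ x) _ _ _
      (rep-suc 0∈ x (beyond (suc x) (s≤s (m+n≤o⇒n≤o (suc d') d'+F<x))))
      (gapPairs-boundary x d'+F<x)

  x₀ : ℕ
  x₀ = (F + F') ⊓ (d + d)

  -- Acuteness is exactly what puts x₀ into the range of rep-step.
  d'+F<x₀ : suc d' + F ≤ x₀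
  d'+F<x₀ = ⊓-glb (subst (suc d' + F ≤_) (+-comm F' F) (+-monoˡ-< F d'<F'))
                  (≤-trans (s≤s acute) (+-monoˡ-< d F'<d))

  -- Both F + F' and 2d exceed F' + d, since F' < d < F.
  F'+d<x₀ : F' + d < x₀
  F'+d<x₀ = ⊓-glb (subst (F' + d <_) (+-comm F' F) (+-monoʳ-< F' d<F)) (+-monoˡ-< d F'<d)

  beyond-x₀ : ∀ {x} → x₀ < x → suc d' + F ≤ x
  beyond-x₀ x₀<x = ≤-trans d'+F<x₀ (<⇒≤ x₀<x)

  -- At x₀, x₀ − F' ∈ (d, F] and x₀ − F ∈ (d', F'] are gaps while
  -- x₀ − d ∈ (F', d] is an element.
  rep-drops : rep x₀ ≡ suc (rep (suc x₀))
  rep-drops = drop-by-one (begin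
    rep (suc x₀) + 1 + 1
      ≡⟨ cong₂ (λ u v → rep (suc x₀) + u + v) (sym (χgap-gap x₀∸F'-gap)) (sym (χgap-gap x₀∸F-gap)) ⟩
    rep (suc x₀) + χ (gap (x₀ ∸ F')) + χ (gap (x₀ ∸ F))
      ≡⟨ rep-step x₀ d'+F<x₀ ⟩
    suc (rep x₀) + χ (gap (x₀ ∸ d))
      ≡⟨ cong (suc (rep x₀) +_) (χgap-member x₀∸d∈) ⟩
    suc (rep x₀) + 0 ∎)
    where
    open ≡-Reasoning
    x₀∸d∈ : μ (x₀ ∸ d) ≡ true
    x₀∸d∈ = uncurry (middle (x₀ ∸ d)) (∸-between F'+d<x₀ (m⊓n≤n (F + F') (d + d)))
    x₀∸F'-gap : μ (x₀ ∸ F') ≡ false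
    x₀∸F'-gap = uncurry (highGaps (x₀ ∸ F'))
      (∸-between (subst (_< x₀) (+-comm F' d) F'+d<x₀) (subst (x₀ ≤_) (+-comm F F') (m⊓n≤m (F + F') (d + d))))
    x₀∸F-gap : μ (x₀ ∸ F) ≡ false
    x₀∸F-gap = uncurry (lowGaps (x₀ ∸ F)) (∸-between d'+F<x₀ (m⊓n≤m (F + F') (d + d)))

  -- Beyond x₀: if x > F + F' then x − F' ∈ μ, otherwise x > 2d and x − d is a gap.
  rep-rises : ∀ x → x₀ < x → rep x ≤ rep (suc x)
  rep-rises x x₀<x with x ≤? F + F'
  ... | no x≰F+F' =
    no-drop (rep-step x (beyond-x₀ x₀<x)) (≤-trans (≤-reflexive (χgap-member x∸F'∈)) z≤n) (χ≤1 _)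
    where
    x∸F'∈ : μ (x ∸ F') ≡ true
    x∸F'∈ = beyond (x ∸ F') (m+n≤o⇒m≤o∸n (suc F) (≰⇒> x≰F+F'))
  ... | yes x≤F+F' =
    no-drop (rep-step x (beyond-x₀ x₀<x)) (≤-trans (χ≤1 _) (≤-reflexive (sym (χgap-gap x∸d-gap)))) (χ≤1 _)
    where
    2d<x : d + d < x
    2d<x with x ≤? d + d
    ... | yes x≤2d = contradiction (⊓-glb x≤F+F' x≤2d) (<⇒≱ x₀<x)
    ... | no  x≰2d = ≰⇒> x≰2d
    x∸d-gap : μ (x ∸ d) ≡ false
    x∸d-gap = uncurry (highGaps (x ∸ d))
      (∸-between 2d<x (≤-trans x≤F+F' (subst (F + F' ≤_) (+-comm F d) (+-monoʳ-≤ F (<⇒≤ F'<d)))))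

gaps-above-largest : ∀ Λ {x b} → (∀ y → y ∈ Λ → y < b → y ≤ x) → ∀ a → x < a → a < b → mem Λ a ≡ false
gaps-above-largest Λ maximal a x<a a<b = ¬T⇒false (λ a∈ → <⇒≱ x<a (maximal a a∈ a<b))

from-point : ∀ {P : ℕ → Set} F → P F → (∀ n → F < n → P n) → ∀ n → F ≤ n → P n
from-point F PF P>F n F≤n with m≤n⇒m<n∨m≡n F≤n
... | inj₁ F<n  = P>F n F<n
... | inj₂ refl = PF

below-gap : ∀ Λ {x y} → x ∈ Λ → ¬ y ∈ Λ → x < suc y → x < y
below-gap Λ x∈ y∉ x<1+y = ≤∧≢⇒< (s≤s⁻¹ x<1+y) (λ { refl → y∉ x∈ })

-- c − d ≤ c' − d' rearranged without truncated subtraction.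
acute-bound : ∀ {F d F' d'} → d ≤ suc F → d' ≤ suc F' → suc F ∸ d ≤ suc F' ∸ d' → d' + F ≤ F' + d
acute-bound {F} {d} {F'} {d'} d≤c d'≤c' c-d≤c'-d' = s≤s⁻¹ (begin
  suc (d' + F)              ≡⟨ sym (+-suc d' F) ⟩
  d' + suc F                ≡⟨ cong (d' +_) (sym (m∸n+n≡m d≤c)) ⟩
  d' + (suc F ∸ d + d)      ≤⟨ +-monoʳ-≤ d' (+-monoˡ-≤ d c-d≤c'-d') ⟩
  d' + (suc F' ∸ d' + d)    ≡⟨ x∙yz≈yx∙z d' (suc F' ∸ d') d ⟩
  suc F' ∸ d' + d' + d      ≡⟨ cong (_+ d) (m∸n+n≡m d'≤c') ⟩
  suc (F' + d)              ∎)
  where open ≤-Reasoning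

module SemigroupGaps (Λ : NumericalSemigroup) {F d F' d' : ℕ}
  (cond : IsConductor Λ (suc F)) (dom : IsDominant Λ (suc F) d)
  (sub : IsSubconductor Λ d (suc F')) (subd : IsSubdominant Λ (suc F') d') where

  0∈ : mem Λ 0 ≡ true
  0∈ = T⇒true (zero∈ Λ)

  beyond : ∀ a → F < a → mem Λ a ≡ true
  beyond a F<a = T⇒true (proj₁ cond a F<a)

  highGaps : ∀ a → d < a → a ≤ F → mem Λ a ≡ false
  highGaps a d<a a≤F = gaps-above-largest Λ (proj₂ (proj₂ dom)) a d<a (s≤s a≤F)

  middle : ∀ a → F' < a → a ≤ d → mem Λ a ≡ true
  middle a F'<a a≤d = T⇒true (proj₁ (proj₂ sub) a F'<a a≤d)

  lowGaps : ∀ a → d' < a → a ≤ F' → mem Λ a ≡ false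
  lowGaps a d'<a a≤F' = gaps-above-largest Λ (proj₂ (proj₂ subd)) a d'<a (s≤s a≤F')

  -- F = c − 1 is a gap, by minimality of the conductor.
  F∉ : ¬ F ∈ Λ
  F∉ F∈ = n≮n F (proj₂ cond F (from-point F F∈ (proj₁ cond)))

  -- F' = c' − 1 is a gap, by minimality of the subconductor.
  F'∉ : ¬ F' ∈ Λ
  F'∉ F'∈ = n≮n F' (proj₂ (proj₂ sub) F' F'∈ (from-point F' (λ _ → F'∈) (proj₁ (proj₂ sub))))

  d<F : d < F
  d<F = below-gap Λ (proj₁ dom) F∉ (proj₁ (proj₂ dom))

  -- [d, d] ⊆ Λ, so c' ≤ d by minimality of the subconductor.
  F'<d : F' < d
  F'<d = proj₂ (proj₂ sub) d (proj₁ dom) (λ k d≤k k≤d → subst (_∈ Λ) (≤-antisym d≤k k≤d) (proj₁ dom))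

  d'<F' : d' < F'
  d'<F' = below-gap Λ (proj₁ subd) F'∉ (proj₁ (proj₂ subd))

  acute : ¬ IsOrdinary Λ (suc F) → IsAcute Λ (suc F) d (suc F') d' → d' + F ≤ F' + d
  acute nonOrd (inj₁ ord)           = contradiction ord nonOrd
  acute nonOrd (inj₂ (_ , c-d≤c'-d')) =
    acute-bound (<⇒≤ (proj₁ (proj₂ dom))) (<⇒≤ (proj₁ (proj₂ subd))) c-d≤c'-d'

module Enumeration (Λ : NumericalSemigroup) (lam : ℕ → ℕ) (enum : IsEnumeration Λ lam) where

  open PairCounts (mem Λ) using (rep)

  increasing : ∀ i j → i < j → lam i < lam j
  increasing = proj₁ (proj₂ enum)

  onto : ∀ x → x ∈ Λ → ∃ λ i → lam i ≡ x
  onto = proj₂ (proj₂ enum)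

  monotone : ∀ {i j} → i ≤ j → lam i ≤ lam j
  monotone {i} {j} i≤j with m≤n⇒m<n∨m≡n i≤j
  ... | inj₁ i<j  = <⇒≤ (increasing i j i<j)
  ... | inj₂ refl = ≤-refl

  reflects-< : ∀ {i j} → lam i < lam j → i < j
  reflects-< {i} {j} λi<λj with i <? j
  ... | yes i<j = i<j
  ... | no  i≮j = contradiction (monotone (≮⇒≥ i≮j)) (<⇒≱ λi<λj)

  lam0 : lam 0 ≡ 0
  lam0 = let (k , λk≡0) = onto 0 (zero∈ Λ) in n≤0⇒n≡0 (subst (lam 0 ≤_) λk≡0 (monotone z≤n))

  no-skipped : ∀ n y → lam n < y → y < lam (suc n) → mem Λ y ≡ false
  no-skipped n y λn<y y<λn+1 = ¬T⇒false λ y∈ →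
    let (k , λk≡y) = onto y y∈ in
    <⇒≱ (reflects-< (subst (lam n <_) (sym λk≡y) λn<y))
        (s≤s⁻¹ (reflects-< (subst (_< lam (suc n)) (sym λk≡y) y<λn+1)))

  count-enum : ∀ (P : ℕ → Bool) n →
    ∑[ j < suc n ] χ (P (lam j)) ≡ ∑[ a < suc (lam n) ] χ (mem Λ a ∧ P a)
  count-enum P zero rewrite lam0 | T⇒true (zero∈ Λ) = refl
  count-enum P (suc n) = cong₂ _+_
    (cong (λ b → χ (b ∧ P (lam (suc n)))) (sym (T⇒true (proj₁ enum (suc n)))))
    (trans (count-enum P n)
           (sym (sum-extend (λ a → χ (mem Λ a ∧ P a)) (≤⇒≤′ (increasing n (suc n) ≤-refl))
                  (λ a λn<a a<λn+1 → cong (λ b → χ (b ∧ P a)) (no-skipped n a λn<a a<λn+1)))))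

  ν≡rep : ∀ i → ν Λ lam i ≡ rep (lam i)
  ν≡rep i = begin
    ν Λ lam i
      ≡⟨ countBelow-sum _ (suc i) ⟩
    ∑[ j < suc i ] χ (P (lam j))
      ≡⟨ count-enum P i ⟩
    ∑[ a < suc (lam i) ] χ (mem Λ a ∧ P a)
      ≡⟨ sum-cong (suc (lam i)) (λ a a≤λi →
           cong (λ b → χ (mem Λ a ∧ (b ∧ mem Λ (lam i ∸ a)))) (T⇒true (≤⇒≤ᵇ (s≤s⁻¹ a≤λi)))) ⟩
    rep (lam i) ∎
    where
    open ≡-Reasoning
    P : ℕ → Bool
    P a = (a ≤ᵇ lam i) ∧ mem Λ (lam i ∸ a)

  next-element : ∀ i → suc (lam i) ∈ Λ → lam (suc i) ≡ suc (lam i)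
  next-element i λi+1∈ with onto (suc (lam i)) λi+1∈
  ... | k , λk≡λi+1 = ≤-antisym
    (subst (lam (suc i) ≤_) λk≡λi+1 (monotone (reflects-< (subst (lam i <_) (sym λk≡λi+1) ≤-refl))))
    (increasing i (suc i) ≤-refl)

  ν-next : ∀ i → suc (lam i) ∈ Λ → ν Λ lam (suc i) ≡ rep (suc (lam i))
  ν-next i λi+1∈ = trans (ν≡rep (suc i)) (cong rep (next-element i λi+1∈))

mainTheorem11 : (Λ : NumericalSemigroup) (lam : ℕ → ℕ) (c d c' d' : ℕ)
    → IsEnumeration Λ lam → IsConductor Λ c → IsDominant Λ c d
    → IsSubconductor Λ d c' → IsSubdominant Λ c' d'
    → ¬ IsOrdinary Λ c → IsAcute Λ c d c' d'
    → (k₁ k₂ : ℕ) → lam k₁ ≡ c + c' ∸ 2 → lam k₂ ≡ 2 * d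
    → ν Λ lam (k₁ ⊓ k₂) > ν Λ lam (suc (k₁ ⊓ k₂))
    × (∀ i → k₁ ⊓ k₂ < i → ν Λ lam i ≤ ν Λ lam (suc i))
mainTheorem11 Λ lam zero d c' d' _ _ (_ , () , _) _ _ _ _ _ _ _ _
mainTheorem11 Λ lam (suc F) d zero d' _ _ _ _ (_ , () , _) _ _ _ _ _ _
mainTheorem11 Λ lam (suc F) d (suc F') d' enum cond dom sub subd nonOrd acuteΛ k₁ k₂ λk₁ λk₂ =
  ν-drops , ν-rises
  where
  open SemigroupGaps Λ cond dom sub subd
  open TwoGapIntervals (mem Λ) d' F' d F d'<F' F'<d d<F 0∈ lowGaps middle highGaps beyond (acute nonOrd acuteΛ)
  open Enumeration Λ lam enum
  open PairCounts (mem Λ) using (rep)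

  m : ℕ
  m = k₁ ⊓ k₂

  -- λ_m = min(λ_{k₁}, λ_{k₂}) = min(F + F', 2d).
  λm≡x₀ : lam m ≡ x₀
  λm≡x₀ = trans (mono-≤-distrib-⊓ monotone k₁ k₂)
                (cong₂ _⊓_ (trans λk₁ (cong (_∸ 1) (+-suc F F'))) (trans λk₂ (cong (d +_) (+-identityʳ d))))

  -- From x₀ on, λ_i ≥ c, so λ_{i+1} = λ_i + 1.
  ν-next-past-x₀ : ∀ i → x₀ ≤ lam i → ν Λ lam (suc i) ≡ rep (suc (lam i))
  ν-next-past-x₀ i x₀≤λi = ν-next i (proj₁ cond (suc (lam i)) (s≤s (≤-trans (m+n≤o⇒n≤o (suc d') d'+F<x₀) x₀≤λi)))

  ν-drops : ν Λ lam m > ν Λ lam (suc m)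
  ν-drops = ≤-reflexive (begin
    suc (ν Λ lam (suc m))  ≡⟨ cong suc (ν-next-past-x₀ m (≤-reflexive (sym λm≡x₀))) ⟩
    suc (rep (suc (lam m))) ≡⟨ cong (λ x → suc (rep (suc x))) λm≡x₀ ⟩
    suc (rep (suc x₀))      ≡⟨ sym rep-drops ⟩
    rep x₀                  ≡⟨ cong rep (sym λm≡x₀) ⟩
    rep (lam m)             ≡⟨ sym (ν≡rep m) ⟩
    ν Λ lam m               ∎)
    where open ≡-Reasoning

  ν-rises : ∀ i → m < i → ν Λ lam i ≤ ν Λ lam (suc i)
  ν-rises i m<i = subst₂ _≤_ (sym (ν≡rep i)) (sym (ν-next-past-x₀ i (<⇒≤ x₀<λi))) (rep-rises (lam i) x₀<λi)
    where
    x₀<λi : x₀ < lam i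
    x₀<λi = subst (_< lam i) λm≡x₀ (increasing m i m<i)
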